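{- Let $(\mathcal{P},\sim,\cdot)$ be a hereditary family of lattices and let $P\in\mathcal{P}$ be indecomposable. Then $P$ is super-upper-indecomposable if and only if for every $x\in P$ such that $[\hat 0,x]$ is indecomposable, the lattice $[\hat 0,x]$ is upper-indecomposable.
   Context: An interval is a finite poset with a unique minimum $\hat 0$ and maximum $\hat 1$; $[x,y]=\{z:x\le z\le y\}$. A hereditary family $(\mathcal{P},\sim,\cdot)$ is a family of finite intervals closed under subintervals, with a product $PQ$ and an equivalence $\sim$ such that for all $P,Q,R$: (1) $P\sim Q\Rightarrow PR\sim QR$; (2) $(PQ)R\sim P(QR)$, $IP\sim PI\sim P$ for single-element $I$, $PQ\sim QP$; (3) if $P\sim Q$ there is a bijection $x\mapsto x'$ with $[\hat 0_P,x]\sim[\hat 0_Q,x']$, $[x,\hat 1_P]\sim[x',\hat 1_Q]$; (4) there is a poset isomorphism $\psi:P\times Q\to PQ$ with $[\psi(\hat 0,\hat 0),\psi(x,y)]\sim[\hat 0_P,x][\hat 0_Q,y]$ and $[\psi(x,y),\psi(\hat 1,\hat 1)]\sim[x,\hat 1_P][y,\hat 1_Q]$. All members are lattices. $P$ is decomposable if it is $\sim$ to a nontrivial product of non-singleton posets of $\mathcal{P}$, else indecomposable. An indecomposable lattice $P\in\mathcal{P}$ is upper-indecomposable if for every $x<\hat 1$ in $P$ the interval $[x,\hat 1]$ is indecomposable. An indecomposable lattice $P\in\mathcal{P}$ is super-upper-indecomposable if every indecomposable interval $[x,y]$ of $P$ is upper-indecomposable. -}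

module Defs where

open import Level using (0ℓ)
open import Data.Nat using (ℕ)
open import Data.Fin using (Fin)
open import Data.Product using (Σ; Σ-syntax; _×_; _,_; proj₁; proj₂)
open import Data.Empty using (⊥)
open import Relation.Nullary using (¬_)
open import Relation.Binary.Core using (Rel)
open import Relation.Binary.Definitions using (Irrelevant)
open import Relation.Binary.Structures using (IsEquivalence; IsPartialOrder)
open import Relation.Binary.PropositionalEquality using (_≡_)
open import Relation.Binary.Lattice.Structures using (IsBoundedLattice)
open import Algebra.Core using (Op₂)
open import Function.Bundles using (_↔_; Inverse)

record FinBoundedLattice : Set₁ where
  field
    Carrier      : Set
    _≤_          : Rel Carrier 0ℓ
    _∨_          : Op₂ Carrier
    _∧_          : Op₂ Carrier
    top          : Carrier
    bot          : Carrier
    isBoundedLattice : IsBoundedLattice _≡_ _≤_ _∨_ _∧_ top bot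
    ≤-irrelevant : Irrelevant _≤_
    finite       : Σ[ n ∈ ℕ ] (Carrier ↔ Fin n)

  open IsBoundedLattice isBoundedLattice public
    using (isPartialOrder; maximum; minimum)
  open IsPartialOrder isPartialOrder public using (refl; trans; antisym)

-- The family is presented by a type Obj of "ambient" lattices; the members
-- are all intervals [x,y] (x ≤ y) of ambient lattices.  Hence the family is
-- closed under subintervals by construction, and an interval of an interval
-- [x,y] of P is literally an interval of P.  An ambient lattice P itself is
-- the member [0̂,1̂] of P.

module Intervals {Obj : Set} (lat : Obj → FinBoundedLattice) where

  private
    module L (P : Obj) = FinBoundedLattice (lat P)

  Member : Set
  Member = Σ[ P ∈ Obj ] Σ[ x ∈ L.Carrier P ] Σ[ y ∈ L.Carrier P ] L._≤_ P x y

  amb : Member → Obj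
  amb (P , _) = P

  Elem : Member → Set
  Elem (P , x , y , _) = Σ[ z ∈ L.Carrier P ] (L._≤_ P x z × L._≤_ P z y)

  _⊑[_]_ : {M : Member} → Elem M → (M' : Member) → Elem M → Set
  _⊑[_]_ {P , _} a _ b = L._≤_ P (proj₁ a) (proj₁ b)

  _⊑_ : {M : Member} → Elem M → Elem M → Set
  _⊑_ {M} a b = _⊑[_]_ {M} a M b

  0̂ : (M : Member) → Elem M
  0̂ (P , x , y , x≤y) = x , L.refl P , x≤y

  1̂ : (M : Member) → Elem M
  1̂ (P , x , y , x≤y) = y , x≤y , L.refl P

  0̂-min : (M : Member) (a : Elem M) → _⊑_ {M} (0̂ M) a
  0̂-min (P , x , y , _) (z , x≤z , z≤y) = x≤z

  1̂-max : (M : Member) (a : Elem M) → _⊑_ {M} a (1̂ M)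
  1̂-max (P , x , y , _) (z , x≤z , z≤y) = z≤y

  _⊏_ : {M : Member} → Elem M → Elem M → Set
  _⊏_ {M} a b = _⊑_ {M} a b × ¬ (proj₁ a ≡ proj₁ b)

  sub : (M : Member) (a b : Elem M) → _⊑_ {M} a b → Member
  sub (P , _) a b a≤b = P , proj₁ a , proj₁ b , a≤b

  whole : Obj → Member
  whole P = P , L.bot P , L.top P , L.minimum P (L.top P)

  Singleton : Member → Set
  Singleton (P , x , y , _) = x ≡ y

record IsHereditaryFamily {Obj : Set} (lat : Obj → FinBoundedLattice)
         (_∼_ : Rel (Intervals.Member lat) 0ℓ)
         (_·_ : Op₂ (Intervals.Member lat)) : Set where
  open Intervals lat
  field
    ∼-isEquivalence : IsEquivalence _∼_
    ·-congʳ : ∀ {P Q} R → P ∼ Q → (P · R) ∼ (Q · R)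
    ·-assoc : ∀ P Q R → ((P · Q) · R) ∼ (P · (Q · R))
    ·-identityˡ : ∀ I P → Singleton I → (I · P) ∼ P
    ·-identityʳ : ∀ I P → Singleton I → (P · I) ∼ P
    ·-comm : ∀ P Q → (P · Q) ∼ (Q · P)
    ∼-intervals : ∀ {P Q} → P ∼ Q →
      Σ[ f ∈ (Elem P ↔ Elem Q) ]
        (∀ (x : Elem P) →
            (sub P (0̂ P) x (0̂-min P x) ∼ sub Q (0̂ Q) (Inverse.to f x) (0̂-min Q (Inverse.to f x)))
          × (sub P x (1̂ P) (1̂-max P x) ∼ sub Q (Inverse.to f x) (1̂ Q) (1̂-max Q (Inverse.to f x))))
    product : ∀ P Q →
      Σ[ ψ ∈ ((Elem P × Elem Q) ↔ Elem (P · Q)) ]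
        ( (∀ (a b : Elem P × Elem Q) →
             ((_⊑_ {P} (proj₁ a) (proj₁ b) × _⊑_ {Q} (proj₂ a) (proj₂ b))
               → _⊑_ {P · Q} (Inverse.to ψ a) (Inverse.to ψ b))
           × (_⊑_ {P · Q} (Inverse.to ψ a) (Inverse.to ψ b)
               → (_⊑_ {P} (proj₁ a) (proj₁ b) × _⊑_ {Q} (proj₂ a) (proj₂ b))))
        × (∀ (x : Elem P) (y : Elem Q) →
             (Σ[ h ∈ _⊑_ {P · Q} (Inverse.to ψ (0̂ P , 0̂ Q)) (Inverse.to ψ (x , y)) ]
                (sub (P · Q) (Inverse.to ψ (0̂ P , 0̂ Q)) (Inverse.to ψ (x , y)) h
                  ∼ (sub P (0̂ P) x (0̂-min P x) · sub Q (0̂ Q) y (0̂-min Q y))))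
           × (Σ[ h ∈ _⊑_ {P · Q} (Inverse.to ψ (x , y)) (Inverse.to ψ (1̂ P , 1̂ Q)) ]
                (sub (P · Q) (Inverse.to ψ (x , y)) (Inverse.to ψ (1̂ P , 1̂ Q)) h
                  ∼ (sub P x (1̂ P) (1̂-max P x) · sub Q y (1̂ Q) (1̂-max Q y))))))

record HereditaryFamily : Set₁ where
  field
    Obj  : Set
    lat  : Obj → FinBoundedLattice
    _∼_  : Rel (Intervals.Member lat) 0ℓ
    _·_  : Op₂ (Intervals.Member lat)
    isHereditaryFamily : IsHereditaryFamily lat _∼_ _·_

module Notions (𝒫 : HereditaryFamily) where
  open HereditaryFamily 𝒫
  open Intervals lat public

  Decomposable : Member → Set
  Decomposable M = Σ[ A ∈ Member ] Σ[ B ∈ Member ]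
    (¬ Singleton A × ¬ Singleton B × (M ∼ (A · B)))

  Indecomposable : Member → Set
  Indecomposable M = ¬ Decomposable M

  UpperIndecomposable : Member → Set
  UpperIndecomposable M = Indecomposable M ×
    (∀ (x : Elem M) → _⊏_ {M} x (1̂ M) → Indecomposable (sub M x (1̂ M) (1̂-max M x)))

  SuperUpperIndecomposable : Member → Set
  SuperUpperIndecomposable M = Indecomposable M ×
    (∀ (x y : Elem M) (h : _⊑_ {M} x y) →
       Indecomposable (sub M x y h) → UpperIndecomposable (sub M x y h))

-- Induct on the top w of the lower interval L = [0̂,w].  If L is indecomposable
-- the hypothesis makes it upper-indecomposable, and so are its indecomposable
-- upper intervals.  If L ∼ A·B with A, B non-singleton, an indecomposable upper
-- interval [a,w] ∼ [a_A,1̂]·[a_B,1̂] must have a trivial factor, say the second;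
-- then [a,w] ∼ [a_A,1̂_A], and A ∼ [0̂,m] for some m < w, so [a,w] is ∼ to an
-- upper interval of the smaller lower interval [0̂,m].
module Submission where

open import Defs
open import Level using (0ℓ)
open import Data.Fin using (Fin)
open import Data.Fin.Induction using (po-wellFounded)
open import Data.Nat using (ℕ)
open import Data.Product using (Σ-syntax; _×_; _,_; proj₁; proj₂)
open import Function.Bundles using (_⇔_; _↔_; Inverse; mk⇔)
open import Induction.WellFounded using (WellFounded; module Subrelation; module All)
open import Relation.Nullary using (¬_)
open import Relation.Binary.Core using (Rel)
open import Relation.Binary.Structures using (IsEquivalence; IsPartialOrder)
open import Relation.Binary.PropositionalEquality using (_≡_; refl; sym; trans; cong; cong₂; subst; module ≡-Reasoning)
import Relation.Binary.Construct.NonStrictToStrict as ToStrict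
import Relation.Binary.Construct.On as On

finite-<-wellFounded : {A : Set} {_≤_ : Rel A 0ℓ} {n : ℕ} →
  IsPartialOrder _≡_ _≤_ → A ↔ Fin n → WellFounded (ToStrict._<_ _≡_ _≤_)
finite-<-wellFounded {_≤_ = _≤_} ≤-po A↔Fin =
  Subrelation.wellFounded through-Fin (On.wellFounded to (po-wellFounded (On.isPartialOrder from ≤-po)))
  where
  open Inverse A↔Fin
  through-Fin : ∀ {c d} → ToStrict._<_ _≡_ _≤_ c d →
    ToStrict._<_ _≡_ _≤_ (from (to c)) (from (to d))
  through-Fin {c} {d} c<d rewrite strictlyInverseʳ c | strictlyInverseʳ d = c<d

module _ (𝒫 : HereditaryFamily) where
  open HereditaryFamily 𝒫
  open Notions 𝒫
  open IsHereditaryFamily isHereditaryFamily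
  open IsEquivalence ∼-isEquivalence using () renaming (reflexive to ∼-reflexive; sym to ∼-sym; trans to ∼-trans)
  private
    module L (Q : Obj) = FinBoundedLattice (lat Q)

  lower : (M : Member) → Elem M → Member
  lower M x = sub M (0̂ M) x (0̂-min M x)

  upper : (M : Member) → Elem M → Member
  upper M x = sub M x (1̂ M) (1̂-max M x)

  inject-lower : ∀ {M} (w : Elem M) → Elem (lower M w) → Elem M
  inject-lower {M} w (z , 0̂≤z , z≤w) = z , 0̂≤z , L.trans (amb M) z≤w (1̂-max M w)

  inject-upper : ∀ {M} (a : Elem M) → Elem (upper M a) → Elem M
  inject-upper {M} a (z , a≤z , z≤1̂) = z , L.trans (amb M) (0̂-min M a) a≤z , z≤1̂

  Elem-≡ : (M : Member) {a b : Elem M} → proj₁ a ≡ proj₁ b → a ≡ b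
  Elem-≡ (Q , _) {z , p , q} {.z , p′ , q′} refl =
    cong₂ (λ u v → z , u , v) (L.≤-irrelevant Q p p′) (L.≤-irrelevant Q q q′)

  Member-≡ : (Q : Obj) {x x′ y y′ : L.Carrier Q} (h : L._≤_ Q x y) (h′ : L._≤_ Q x′ y′) →
    x ≡ x′ → y ≡ y′ → _≡_ {A = Member} (Q , x , y , h) (Q , x′ , y′ , h′)
  Member-≡ Q h h′ refl refl = cong (λ u → Q , _ , _ , u) (L.≤-irrelevant Q h h′)

  Singleton⇒≡0̂ : (M : Member) → Singleton M → (a : Elem M) → a ≡ 0̂ M
  Singleton⇒≡0̂ M@(Q , x , .x , _) refl a@(_ , x≤a , a≤x) = Elem-≡ M (L.antisym Q a≤x x≤a)

  Singleton-resp-∼ : ∀ {M N} → M ∼ N → Singleton M → Singleton N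
  Singleton-resp-∼ {M} {N} M∼N single = cong proj₁ (begin
    0̂ N              ≡⟨ sym (strictlyInverseˡ (0̂ N)) ⟩
    to (from (0̂ N))  ≡⟨ cong to (trans (≡0̂ (from (0̂ N))) (sym (≡0̂ (from (1̂ N))))) ⟩
    to (from (1̂ N))  ≡⟨ strictlyInverseˡ (1̂ N) ⟩
    1̂ N              ∎)
    where
    open ≡-Reasoning
    open Inverse (proj₁ (∼-intervals M∼N))
    ≡0̂ : (a : Elem M) → a ≡ 0̂ M
    ≡0̂ = Singleton⇒≡0̂ M single

  Indecomposable-resp-∼ : ∀ {M N} → M ∼ N → Indecomposable M → Indecomposable N
  Indecomposable-resp-∼ M∼N ind (A , B , A≠ , B≠ , N∼AB) = ind (A , B , A≠ , B≠ , ∼-trans M∼N N∼AB)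

  upper-resp-∼ : ∀ {M N} → M ∼ N → (a : Elem M) → Σ[ b ∈ Elem N ] (upper M a ∼ upper N b)
  upper-resp-∼ M∼N a = Inverse.to (proj₁ (∼-intervals M∼N)) a , proj₂ (proj₂ (∼-intervals M∼N) a)

  UpperIndecomposable-resp-∼ : ∀ {M N} → M ∼ N → UpperIndecomposable M → UpperIndecomposable N
  UpperIndecomposable-resp-∼ {M} {N} M∼N (ind , upper-ind) =
    Indecomposable-resp-∼ M∼N ind , λ b (_ , b≢1̂) →
      let (a , Nb∼Ma) = upper-resp-∼ (∼-sym M∼N) b
          a≢1̂ = λ a≡1̂ → b≢1̂ (Singleton-resp-∼ (∼-sym Nb∼Ma) a≡1̂)
      in Indecomposable-resp-∼ (∼-sym Nb∼Ma) (upper-ind a (1̂-max M a , a≢1̂))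

  UpperIndecomposable-stable : ∀ {M} → ¬ ¬ UpperIndecomposable M → UpperIndecomposable M
  UpperIndecomposable-stable ¬¬ui =
    (λ dec → ¬¬ui λ ui → proj₁ ui dec) , λ b b<1̂ dec → ¬¬ui λ ui → proj₂ ui b b<1̂ dec

  UpperIndecomposable-upper : ∀ {M} → UpperIndecomposable M → (a : Elem M) →
    Indecomposable (upper M a) → UpperIndecomposable (upper M a)
  UpperIndecomposable-upper {M} (_ , upper-ind) a ind =
    ind , λ b b<1̂ → upper-ind (inject-upper {M} a b) b<1̂

  module Product (A B : Member) where
    open Inverse (proj₁ (product A B)) public using (to; from; strictlyInverseˡ)

    private
      monotone : ∀ a b → (_⊑_ {A} (proj₁ a) (proj₁ b) × _⊑_ {B} (proj₂ a) (proj₂ b)) →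
        _⊑_ {A · B} (to a) (to b)
      monotone a b = proj₁ (proj₁ (proj₂ (product A B)) a b)

    to-0̂ : to (0̂ A , 0̂ B) ≡ 0̂ (A · B)
    to-0̂ = Elem-≡ (A · B) (L.antisym (amb (A · B)) to-0̂≤0̂ (0̂-min (A · B) (to (0̂ A , 0̂ B))))
      where
      c = from (0̂ (A · B))
      to-0̂≤0̂ : _⊑_ {A · B} (to (0̂ A , 0̂ B)) (0̂ (A · B))
      to-0̂≤0̂ = subst (_⊑_ {A · B} (to (0̂ A , 0̂ B))) (strictlyInverseˡ (0̂ (A · B)))
        (monotone (0̂ A , 0̂ B) c (0̂-min A (proj₁ c) , 0̂-min B (proj₂ c)))

    to-1̂ : to (1̂ A , 1̂ B) ≡ 1̂ (A · B)
    to-1̂ = Elem-≡ (A · B) (L.antisym (amb (A · B)) (1̂-max (A · B) (to (1̂ A , 1̂ B))) 1̂≤to-1̂)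
      where
      c = from (1̂ (A · B))
      1̂≤to-1̂ : _⊑_ {A · B} (1̂ (A · B)) (to (1̂ A , 1̂ B))
      1̂≤to-1̂ = subst (λ d → _⊑_ {A · B} d (to (1̂ A , 1̂ B))) (strictlyInverseˡ (1̂ (A · B)))
        (monotone c (1̂ A , 1̂ B) (1̂-max A (proj₁ c) , 1̂-max B (proj₂ c)))

    lower-to : ∀ x y → lower (A · B) (to (x , y)) ∼ (lower A x · lower B y)
    lower-to x y = ∼-trans (∼-reflexive (Member-≡ (amb (A · B)) _ _ (cong proj₁ (sym to-0̂)) refl))
      (proj₂ (proj₁ (proj₂ (proj₂ (product A B)) x y)))

    upper-to : ∀ x y → upper (A · B) (to (x , y)) ∼ (upper A x · upper B y)
    upper-to x y = ∼-trans (∼-reflexive (Member-≡ (amb (A · B)) _ _ refl (cong proj₁ (sym to-1̂))))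
      (proj₂ (proj₂ (proj₂ (proj₂ (product A B)) x y)))

  upper-decomposition : ∀ {M A B} → M ∼ (A · B) → (a : Elem M) →
    Σ[ x ∈ Elem A ] Σ[ y ∈ Elem B ] (upper M a ∼ (upper A x · upper B y))
  upper-decomposition {M} {A} {B} M∼AB a =
    let (c , Ma∼ABc) = upper-resp-∼ M∼AB a
        (x , y) = from c
    in x , y , ∼-trans Ma∼ABc (∼-trans (∼-reflexive (cong (upper (A · B)) (sym (strictlyInverseˡ c))))
                                        (upper-to x y))
    where open Product A B

  -- The splitting point is ψ(1̂,0̂): below it [0̂,1̂]·[0̂,0̂] ∼ A, above it [1̂,1̂]·[0̂,1̂] ∼ B.
  decomposition-point : ∀ {M A B} → M ∼ (A · B) →
    Σ[ m ∈ Elem M ] ((lower M m ∼ A) × (upper M m ∼ B))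
  decomposition-point {M} {A} {B} M∼AB =
    Inverse.to (proj₁ transport) c
      , ∼-trans (∼-sym (proj₁ c-intervals)) (∼-trans (lower-to (1̂ A) (0̂ B)) (·-identityʳ _ A refl))
      , ∼-trans (∼-sym (proj₂ c-intervals)) (∼-trans (upper-to (1̂ A) (0̂ B)) (·-identityˡ _ B refl))
    where
    open Product A B
    c : Elem (A · B)
    c = to (1̂ A , 0̂ B)
    transport = ∼-intervals (∼-sym M∼AB)
    c-intervals = proj₂ transport c

  UpperOfProperLower : (M : Member) → Elem M → Set
  UpperOfProperLower M a = Σ[ m ∈ Elem M ] (_⊏_ {M} m (1̂ M) ×
    Σ[ a′ ∈ Elem (lower M m) ] (upper M a ∼ upper (lower M m) a′))

  indecomposable-upper-descends : ∀ {M} → Decomposable M → (a : Elem M) →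
    Indecomposable (upper M a) → ¬ ¬ UpperOfProperLower M a
  indecomposable-upper-descends {M} (A , B , A≠ , B≠ , M∼AB) a ind ¬lower =
    let (x , y , Ma∼AxBy) = upper-decomposition M∼AB a in
    ind ( upper A x , upper B y
        , (λ Ax-single → ¬lower (descend (∼-trans M∼AB (·-comm A B)) A≠ y
                                   (∼-trans Ma∼AxBy (·-identityˡ _ _ Ax-single))))
        , (λ By-single → ¬lower (descend M∼AB B≠ x (∼-trans Ma∼AxBy (·-identityʳ _ _ By-single))))
        , Ma∼AxBy )
    where
    descend : ∀ {A B} → M ∼ (A · B) → ¬ Singleton B → (x : Elem A) →
      upper M a ∼ upper A x → UpperOfProperLower M a
    descend M∼AB B≠ x Ma∼Ax =
      let (m , Mm∼A , Mm∼B) = decomposition-point M∼AB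
          (a′ , Ax∼Mma′) = upper-resp-∼ (∼-sym Mm∼A) x
      in m , (1̂-max M m , λ m≡1̂ → B≠ (Singleton-resp-∼ Mm∼B m≡1̂)) , a′ , ∼-trans Ma∼Ax Ax∼Mma′

  ⊏-wellFounded : (M : Member) → WellFounded (_⊏_ {M})
  ⊏-wellFounded M = On.wellFounded proj₁
    (finite-<-wellFounded (L.isPartialOrder (amb M)) (proj₂ (L.finite (amb M))))

  upper-of-lower-upperIndecomposable : (P : Member) →
    (∀ x → Indecomposable (lower P x) → UpperIndecomposable (lower P x)) →
    ∀ w a → Indecomposable (upper (lower P w) a) → UpperIndecomposable (upper (lower P w) a)
  upper-of-lower-upperIndecomposable P lower-upperInd = All.wfRec (⊏-wellFounded P) _ Claim step
    where
    Claim : Elem P → Set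
    Claim w = ∀ a → Indecomposable (upper (lower P w) a) → UpperIndecomposable (upper (lower P w) a)

    -- Upper-indecomposability is negative, so we may case on whether [0̂,w] is decomposable.
    step : ∀ w → (∀ {v} → _⊏_ {P} v w → Claim v) → Claim w
    step w below a ind = UpperIndecomposable-stable λ ¬ui →
      let lower-ind : Indecomposable (lower P w)
          lower-ind dec = indecomposable-upper-descends dec a ind λ (m , m<w , a′ , e) →
            ¬ui (UpperIndecomposable-resp-∼ (∼-sym e)
                  (below {inject-lower {P} w m} m<w a′ (Indecomposable-resp-∼ e ind)))
      in ¬ui (UpperIndecomposable-upper (lower-upperInd w lower-ind) a ind)

mainTheorem4 : (𝒫 : HereditaryFamily) → let open Notions 𝒫 in
    (P : Member) → Indecomposable P →
      (SuperUpperIndecomposable P ⇔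
        (∀ (x : Elem P) → Indecomposable (sub P (0̂ P) x (0̂-min P x)) →
           UpperIndecomposable (sub P (0̂ P) x (0̂-min P x))))
mainTheorem4 𝒫 P ind = mk⇔
  (λ (_ , sui) x → sui (0̂ P) x (0̂-min P x))
  (λ lower-upperInd → ind , λ x y x≤y →
     upper-of-lower-upperIndecomposable 𝒫 P lower-upperInd y (proj₁ x , 0̂-min P x , x≤y))
  where open Notions 𝒫
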